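{- Let $2\le r\le s$ and $1\le\ell<s$ be integers. Then for every $m\ge1$, $$\mu^{(r)}(P_m^{(s,\ell)})=\begin{cases}\frac1r&\text{if } r\le s-\ell,\\ \frac{m}{(s-\ell)m+\ell-s+r}&\text{otherwise},\end{cases}$$ and, for $m\ge\lfloor (s+1)/(s-\ell)\rfloor$, $$\mu^{(r)}(C_m^{(s,\ell)})=\max\left\{\frac m{(s-\ell)m-s+r},\frac1r\right\},$$ which equals $\frac1r$ if $r\le s-2\ell$ and equals $\frac m{(s-\ell)m-s+r}$ if $r\ge s-\ell$. In particular, for $r\ge s-\ell$, $C_m^{(s,\ell)}$ is $r$-balanced.
   Context: For an $s$-graph $H$ with $v_H\ge s$ vertices and $e_H$ edges, $f^{(r)}(H)=\frac{e_H}{v_H-s+r}$, $\mu^{(r)}(H)=\max\{f^{(r)}(H'):H'\subseteq H,\ v_{H'}\ge s\}$, and $H$ is $r$-balanced if $\mu^{(r)}(H)=f^{(r)}(H)$. The $\ell$-tight $s$-uniform cycle $C_m^{(s,\ell)}$ has $(s-\ell)m$ vertices in cyclic order and $m$ edges, each a segment of $s$ consecutive vertices, evenly spread so that consecutive edges share exactly $\ell$ vertices. The $\ell$-tight $s$-path $P_m^{(s,\ell)}$ has $(s-\ell)m+\ell$ vertices in linear order and $m$ edges, each a segment of $s$ consecutive vertices, consecutive edges sharing exactly $\ell$ vertices. -}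

module Defs where

open import Data.Nat using (ℕ; zero; suc; _+_; _*_; _∸_; _≤_; _<_)
import Data.Nat as ℕ
open import Data.Integer using (+_)
open import Data.Rational using (ℚ; 0ℚ; _/_)
import Data.Rational as ℚ
open import Data.Fin using (Fin; toℕ)
open import Data.Fin.Subset using (Subset; _∈_; ∣_∣)
open import Data.Product using (Σ; _×_; ∃)
open import Relation.Binary.PropositionalEquality using (_≡_)

-- a/b as a rational; b = 0 never occurs in the statement (denominators are
-- v - s + r with v ≥ s and r ≥ 2), the zero case is only a totality convention.
frac : ℕ → ℕ → ℚ
frac a zero    = 0ℚ
frac a (suc b) = (+ a) / suc b

-- ⌊ a / b ⌋ (b = 0 never occurs in the statement since ℓ < s)
floorDiv : ℕ → ℕ → ℕ
floorDiv a zero    = 0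
floorDiv a (suc b) = a ℕ./ suc b

-- A (multi-)hypergraph on vertex set Fin n with m edges indexed by Fin m;
-- H i j means "vertex j belongs to edge i".
HG : ℕ → ℕ → Set₁
HG n m = Fin m → Fin n → Set

record Sub {n m : ℕ} (H : HG n m) : Set where
  field
    V      : Subset n
    E      : Subset m
    closed : ∀ i j → i ∈ E → H i j → j ∈ V
open Sub public

fSub : {n m : ℕ} {H : HG n m} → ℕ → ℕ → Sub H → ℚ
fSub s r H' = frac ∣ E H' ∣ (∣ V H' ∣ ∸ s + r)

fHG : {n m : ℕ} → HG n m → ℕ → ℕ → ℚ
fHG {n} {m} H s r = frac m (n ∸ s + r)

IsMu : {n m : ℕ} → HG n m → ℕ → ℕ → ℚ → Set
IsMu H s r q =
  (Σ (Sub H) λ H' → (s ≤ ∣ V H' ∣) × (fSub s r H' ≡ q))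
  × (∀ (H' : Sub H) → s ≤ ∣ V H' ∣ → fSub s r H' ℚ.≤ q)

Balanced : {n m : ℕ} → HG n m → ℕ → ℕ → Set
Balanced H s r = IsMu H s r (fHG H s r)

PathHG : (s ℓ m : ℕ) → HG ((s ∸ ℓ) * m + ℓ) m
PathHG s ℓ m i j = (toℕ i * (s ∸ ℓ) ≤ toℕ j) × (toℕ j < toℕ i * (s ∸ ℓ) + s)

-- ℓ-tight s-uniform cycle C_m^{(s,ℓ)}: vertices 0,…,N-1 (N = (s-ℓ)m) in
-- cyclic order, edge i is the cyclic segment {i(s-ℓ)+k mod N : k < s}.
CycleHG : (s ℓ m : ℕ) → HG ((s ∸ ℓ) * m) m
CycleHG s ℓ m i j =
  Σ ℕ λ k → (k < s) × (Σ ℕ λ q → toℕ i * (s ∸ ℓ) + k ≡ toℕ j + q * ((s ∸ ℓ) * m))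

{-# OPTIONS --safe #-}
module Submission where

-- Write d = s − ℓ, so that edge i starts at vertex i d. Scanning a subgraph with e ≥ 1 edges from
-- left to right, every chosen edge but the last contributes d vertices not seen before and the
-- last one contributes s, so the subgraph has v ≥ (e − 1) d + s vertices. In the cycle a subgraph
-- either contains every vertex or misses some vertex x; no chosen edge passes through x, so cutting
-- the cycle at x gives the same bound. Then e / (v − s + r) ≤ e / ((e − 1) d + r), which is at most
-- 1 / r when r ≤ d and increases with e when d ≤ r; so the maximum is attained by a single edge or
-- by the whole hypergraph.

open import Defs
open import Data.Nat using (ℕ; _+_; _*_; _∸_; _≤_; _<_)
open import Data.Rational using (_⊔_)
open import Data.Product using (_×_)
open import Relation.Binary.PropositionalEquality using (_≡_)

open import Data.Bool using (Bool; true; false)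
open import Data.Bool.Properties using (¬-not)
open import Data.Empty using (⊥; ⊥-elim)
open import Data.Unit using (⊤; tt)
open import Data.Fin using (Fin; toℕ; fromℕ<) renaming (zero to fzero; suc to fsuc)
open import Data.Fin.Properties using (toℕ<n; toℕ-fromℕ<; all?; ¬∀⟶∃¬)
open import Data.Fin.Subset using (Subset; _∈_; _∉_; ∣_∣; ⁅_⁆) renaming (⊤ to ⊤ˢ)
open import Data.Fin.Subset.Properties
  using (_∈?_; ∈⊤; ∣⊤∣≡n; ∣p∣≤n; p⊆q⇒∣p∣≤∣q∣; ∣⁅x⁆∣≡1; x∈⁅y⁆⇒x≡y)
import Data.Integer as ℤ
import Data.Integer.Properties as ℤᵖ
open import Data.Nat using (zero; suc; z≤n; s≤s; s≤s⁻¹; s<s⁻¹; NonZero; >-nonZero)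
open import Data.Nat.DivMod
open import Data.Nat.Properties
open import Data.Nat.Solver using (module +-*-Solver)
open import Data.Product using (Σ; _,_; proj₁; proj₂)
import Data.Rational as ℚ
import Data.Rational.Properties as ℚᵖ
open import Data.Rational.Unnormalised using (mkℚᵘ; *≤*)
open import Data.Rational.Unnormalised.Properties using (≤-respˡ-≃; ≤-respʳ-≃; ≃-sym)
open import Data.Sum using (_⊎_; inj₁; inj₂)
open import Data.Vec.Base using (_∷_; []; here; there)
open import Function using (_∘_)
open import Relation.Binary.PropositionalEquality using (refl; sym; trans; cong; cong₂; subst; subst₂; module ≡-Reasoning)
open import Relation.Nullary using (does; yes; no)
open import Relation.Nullary.Decidable using (dec-true; dec-false)

𝟙 : Bool → ℕ
𝟙 true  = 1
𝟙 false = 0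

count : (ℕ → Bool) → ℕ → ℕ → ℕ
count P a zero    = 0
count P a (suc L) = 𝟙 (P (a + L)) + count P a L

AllTrue : (ℕ → Bool) → ℕ → ℕ → Set
AllTrue P a L = ∀ k → k < L → P (a + k) ≡ true

count-cong : ∀ P Q a b L → (∀ k → k < L → P (a + k) ≡ Q (b + k)) → count P a L ≡ count Q b L
count-cong P Q a b zero    eq = refl
count-cong P Q a b (suc L) eq =
  cong₂ _+_ (cong 𝟙 (eq L (n<1+n L))) (count-cong P Q a b L (λ k k<L → eq k (m<n⇒m<1+n k<L)))

module _ (P : ℕ → Bool) where

  count-+ : ∀ a L M → count P a (L + M) ≡ count P a L + count P (a + L) M
  count-+ a L zero    = trans (cong (count P a) (+-identityʳ L)) (sym (+-identityʳ _))
  count-+ a L (suc M) = begin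
    count P a (L + suc M)
      ≡⟨ cong (count P a) (+-suc L M) ⟩
    𝟙 (P (a + (L + M))) + count P a (L + M)
      ≡⟨ cong₂ _+_ (cong (𝟙 ∘ P) (sym (+-assoc a L M))) (count-+ a L M) ⟩
    𝟙 (P (a + L + M)) + (count P a L + count P (a + L) M)
      ≡⟨ x∙yz≈y∙xz (𝟙 (P (a + L + M))) (count P a L) (count P (a + L) M) ⟩
    count P a L + count P (a + L) (suc M)
      ∎
    where open ≡-Reasoning
          open import Algebra.Properties.CommutativeSemigroup +-commutativeSemigroup using (x∙yz≈y∙xz)

  count-cons : ∀ a L → count P a (suc L) ≡ 𝟙 (P a) + count P (suc a) L
  count-cons a L = trans (count-+ a 1 L)
    (cong₂ _+_ (trans (+-identityʳ _) (cong (𝟙 ∘ P) (+-identityʳ a)))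
               (cong (λ c → count P c L) (+-comm a 1)))

  count-mono : ∀ a {L M} → L ≤ M → count P a L ≤ count P a M
  count-mono a {L} {M} L≤M = begin
    count P a L                                ≤⟨ m≤m+n _ _ ⟩
    count P a L + count P (a + L) (M ∸ L)      ≡⟨ count-+ a L (M ∸ L) ⟨
    count P a (L + (M ∸ L))                    ≡⟨ cong (count P a) (m+[n∸m]≡n L≤M) ⟩
    count P a M                                ∎
    where open ≤-Reasoning

  count-all : ∀ a L → AllTrue P a L → count P a L ≡ L
  count-all a zero    all = refl
  count-all a (suc L) all =
    cong₂ _+_ (cong 𝟙 (all L (n<1+n L))) (count-all a L (λ k k<L → all k (m<n⇒m<1+n k<L)))

  count-none : ∀ a L → (∀ k → k < L → P (a + k) ≡ false) → count P a L ≡ 0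
  count-none a zero    none = refl
  count-none a (suc L) none =
    cong₂ _+_ (cong 𝟙 (none L (n<1+n L))) (count-none a L (λ k k<L → none k (m<n⇒m<1+n k<L)))

  count-periodic : ∀ p → (∀ x → P (x + p) ≡ P x) → ∀ c → count P c p ≡ count P 0 p
  count-periodic p periodic zero    = refl
  count-periodic p periodic (suc c) = trans shift (count-periodic p periodic c)
    where
    shift : count P (suc c) p ≡ count P c p
    shift = +-cancelˡ-≡ (𝟙 (P c)) _ _
      (trans (sym (count-cons c p)) (cong (λ b → 𝟙 b + count P c p) (periodic c)))

at : ∀ {n} → Subset n → ℕ → Bool
at []      j       = false
at (x ∷ p) zero    = x
at (x ∷ p) (suc j) = at p j

∣p∣≡count-at : ∀ {n} (p : Subset n) → ∣ p ∣ ≡ count (at p) 0 n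
∣p∣≡count-at []            = refl
∣p∣≡count-at {suc n} (x ∷ p) = begin
  ∣ x ∷ p ∣                      ≡⟨ ∣x∷p∣ x ⟩
  𝟙 x + ∣ p ∣                    ≡⟨ cong (𝟙 x +_) (∣p∣≡count-at p) ⟩
  𝟙 x + count (at p) 0 n         ≡⟨ cong (𝟙 x +_) (count-cong (at p) (at (x ∷ p)) 0 1 n (λ _ _ → refl)) ⟩
  𝟙 x + count (at (x ∷ p)) 1 n   ≡⟨ count-cons (at (x ∷ p)) 0 n ⟨
  count (at (x ∷ p)) 0 (suc n)   ∎
  where
  open ≡-Reasoning
  ∣x∷p∣ : ∀ x → ∣ x ∷ p ∣ ≡ 𝟙 x + ∣ p ∣
  ∣x∷p∣ true  = refl
  ∣x∷p∣ false = refl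

∈⇒at : ∀ {n} {p : Subset n} {i : Fin n} → i ∈ p → at p (toℕ i) ≡ true
∈⇒at here        = refl
∈⇒at (there i∈p) = ∈⇒at i∈p

at⇒∈ : ∀ {n} (p : Subset n) j → at p j ≡ true → Σ (Fin n) λ i → toℕ i ≡ j × i ∈ p
at⇒∈ (x ∷ p) zero    refl = fzero , refl , here
at⇒∈ (x ∷ p) (suc j) eq with at⇒∈ p j eq
... | i , refl , i∈p = fsuc i , refl , there i∈p

at-fromℕ< : ∀ {n j} (p : Subset n) (j<n : j < n) → fromℕ< j<n ∈ p → at p j ≡ true
at-fromℕ< p j<n j∈p = subst (λ k → at p k ≡ true) (toℕ-fromℕ< j<n) (∈⇒at j∈p)

toSubset : (ℕ → Bool) → (n : ℕ) → Subset n
toSubset P zero    = []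
toSubset P (suc n) = P 0 ∷ toSubset (P ∘ suc) n

at-toSubset : ∀ P n k → k < n → at (toSubset P n) k ≡ P k
at-toSubset P (suc n) zero    _   = refl
at-toSubset P (suc n) (suc k) k<n = at-toSubset (P ∘ suc) n k (s<s⁻¹ k<n)

∈-toSubset : ∀ P {n} (i : Fin n) → P (toℕ i) ≡ true → i ∈ toSubset P n
∈-toSubset P fzero    eq rewrite eq = here
∈-toSubset P (fsuc i) eq = there (∈-toSubset (P ∘ suc) i eq)

initialSegment : (s n : ℕ) → Subset n
initialSegment s = toSubset (λ k → does (k <? s))

∣initialSegment∣ : ∀ {s n} → s ≤ n → ∣ initialSegment s n ∣ ≡ s
∣initialSegment∣ {s} {n} s≤n = begin
  ∣ initialSegment s n ∣                        ≡⟨ ∣p∣≡count-at (initialSegment s n) ⟩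
  count (at (initialSegment s n)) 0 n           ≡⟨ count-cong _ below 0 0 n (at-toSubset below n) ⟩
  count below 0 n                               ≡⟨ cong (count below 0) (m+[n∸m]≡n s≤n) ⟨
  count below 0 (s + (n ∸ s))                   ≡⟨ count-+ below 0 s (n ∸ s) ⟩
  count below 0 s + count below s (n ∸ s)       ≡⟨ cong₂ _+_ (count-all below 0 s (λ k k<s → dec-true (k <? s) k<s))
                                                             (count-none below s (n ∸ s) (λ k _ → s+k≮s k)) ⟩
  s + 0                                         ≡⟨ +-identityʳ s ⟩
  s                                             ∎
  where
  open ≡-Reasoning
  below : ℕ → Bool
  below k = does (k <? s)
  s+k≮s : ∀ k → below (s + k) ≡ false
  s+k≮s k = dec-false (s + k <? s) (≤⇒≯ (m≤m+n s k))

module _ {n m : ℕ} (H : HG n m) {s r : ℕ} (s≤n : s ≤ n) where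

  whole-attains : Σ (Sub H) λ H' → (s ≤ ∣ V H' ∣) × (fSub s r H' ≡ fHG H s r)
  whole-attains = whole , subst (s ≤_) (sym (∣⊤∣≡n n)) s≤n ,
                  cong₂ (λ e v → frac e (v ∸ s + r)) (∣⊤∣≡n m) (∣⊤∣≡n n)
    where
    whole : Sub H
    whole = record { V = ⊤ˢ ; E = ⊤ˢ ; closed = λ _ _ _ _ → ∈⊤ }

module _ {n m : ℕ} (H : HG n (suc m)) {s r : ℕ} (s≤n : s ≤ n) (first⊆ : ∀ j → H fzero j → toℕ j < s) where

  firstEdge-attains : Σ (Sub H) λ H' → (s ≤ ∣ V H' ∣) × (fSub s r H' ≡ frac 1 r)
  firstEdge-attains = firstEdge , ≤-reflexive (sym (∣initialSegment∣ s≤n)) ,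
                      trans (cong₂ (λ e v → frac e (v ∸ s + r)) (∣⁅x⁆∣≡1 {n = suc m} fzero)
                                                                   (∣initialSegment∣ s≤n))
                            (cong (λ v → frac 1 (v + r)) (n∸n≡0 s))
    where
    firstEdge : Sub H
    firstEdge = record
      { V = initialSegment s n
      ; E = ⁅ fzero ⁆
      ; closed = λ i j i∈E j∈i → ∈-toSubset _ j (dec-true (toℕ j <? s)
                   (first⊆ j (subst (λ i → H i j) (x∈⁅y⁆⇒x≡y fzero i∈E) j∈i)))
      }

-- frac a (1 + x) is by definition the normal form of mkℚᵘ a x, so compare the unnormalised fractions.
frac-≤ : ∀ a x c y → 1 ≤ x → 1 ≤ y → a * y ≤ c * x → frac a x ℚ.≤ frac c y
frac-≤ a (suc x) c (suc y) _ _ ay≤cx = ℚᵖ.toℚᵘ-cancel-≤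
  (≤-respˡ-≃ (≃-sym (ℚᵖ.toℚᵘ-fromℚᵘ (mkℚᵘ (ℤ.+ a) x)))
  (≤-respʳ-≃ (≃-sym (ℚᵖ.toℚᵘ-fromℚᵘ (mkℚᵘ (ℤ.+ c) y)))
  (*≤* (subst₂ ℤ._≤_ (ℤᵖ.pos-* a (suc y)) (ℤᵖ.pos-* c (suc x)) (ℤ.+≤+ ay≤cx)))))

frac+r-≤ : ∀ {r} → 1 ≤ r → ∀ a x c y → a * (y + r) ≤ c * (x + r) → frac a (x + r) ℚ.≤ frac c (y + r)
frac+r-≤ 1≤r a x c y = frac-≤ a (x + _) c (y + _) (m≤n⇒m≤o+n x 1≤r) (m≤n⇒m≤o+n y 1≤r)

Spans : (d s e v : ℕ) → Set
Spans d s zero    v = ⊤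
Spans d s (suc e) v = e * d + s ≤ v

Spans-mono : ∀ {d s} e {v w} → Spans d s e v → v ≤ w → Spans d s e w
Spans-mono zero    _    _   = tt
Spans-mono (suc e) e≤v v≤w = ≤-trans e≤v v≤w

-- With p = m − e, the two sides differ by p (r − d).
spread-ratio-mono : ∀ {d r e m} → d ≤ r → e ≤ m → suc e * (d * m + r) ≤ suc m * (e * d + r)
spread-ratio-mono {d} {r} {e} d≤r e≤m with m≤n⇒∃[o]m+o≡n e≤m
... | p , refl = +-cancelʳ-≤ (p * r) _ _ (begin
    suc e * (d * (e + p) + r) + p * r  ≡⟨ identity d r e p ⟩
    suc (e + p) * (e * d + r) + p * d  ≤⟨ +-monoʳ-≤ _ (*-monoʳ-≤ p d≤r) ⟩
    suc (e + p) * (e * d + r) + p * r  ∎)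
  where
  open ≤-Reasoning
  open +-*-Solver
  identity : ∀ d r e p → suc e * (d * (e + p) + r) + p * r ≡ suc (e + p) * (e * d + r) + p * d
  identity = solve 4 (λ d r e p → (con 1 :+ e) :* (d :* (e :+ p) :+ r) :+ p :* r
                               := (con 1 :+ e :+ p) :* (e :* d :+ r) :+ p :* d) refl

module _ {d s r : ℕ} (1≤r : 1 ≤ r) where

  private
    excess : ∀ e {v} → e * d + s ≤ v → e * d ≤ v ∸ s
    excess e = m+n≤o⇒m≤o∸n (e * d)

  density≤1/r : r ≤ d → ∀ e v → Spans d s e v → frac e (v ∸ s + r) ℚ.≤ frac 1 r
  density≤1/r r≤d zero    v _      = frac+r-≤ 1≤r 0 (v ∸ s) 1 0 z≤n
  density≤1/r r≤d (suc e) v spans = frac+r-≤ 1≤r (suc e) (v ∸ s) 1 0 (begin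
    r + e * r        ≡⟨ +-comm r (e * r) ⟩
    e * r + r        ≤⟨ +-monoˡ-≤ r (≤-trans (*-monoʳ-≤ e r≤d) (excess e spans)) ⟩
    v ∸ s + r        ≡⟨ *-identityˡ (v ∸ s + r) ⟨
    1 * (v ∸ s + r)  ∎)
    where open ≤-Reasoning

  density≤whole : d ≤ r → ∀ {X m} → X ≤ d * m → ∀ e v → e ≤ suc m → Spans d s e v →
                  frac e (v ∸ s + r) ℚ.≤ frac (suc m) (X + r)
  density≤whole d≤r {X} {m} _ zero v _ _ = frac+r-≤ 1≤r 0 (v ∸ s) (suc m) X z≤n
  density≤whole d≤r {X} {m} X≤dm (suc e) v 1+e≤1+m spans = frac+r-≤ 1≤r (suc e) (v ∸ s) (suc m) X (begin
    suc e * (X + r)          ≤⟨ *-monoʳ-≤ (suc e) (+-monoˡ-≤ r X≤dm) ⟩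
    suc e * (d * m + r)      ≤⟨ spread-ratio-mono d≤r (s≤s⁻¹ 1+e≤1+m) ⟩
    suc m * (e * d + r)      ≤⟨ *-monoʳ-≤ (suc m) (+-monoˡ-≤ r (excess e spans)) ⟩
    suc m * (v ∸ s + r)      ∎)
    where open ≤-Reasoning

module _ (P Q : ℕ → Bool) {b d s W : ℕ} where

  -- Q marks the chosen edges and P the chosen vertices; edge t occupies [b + t d, b + t d + s).
  Runs : ℕ → Set
  Runs T = ∀ t → t < T → Q t ≡ true → AllTrue P (b + t * d) s × b + t * d + s ≤ W

  private
    runs-pred : ∀ {T} → Runs (suc T) → Runs T
    runs-pred runs t t<T = runs t (m<n⇒m<1+n t<T)

  blocks≤count : d ≤ s → ∀ T → Runs T → count Q 0 T * d ≤ count P b (T * d)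
  blocks≤count d≤s zero    _    = z≤n
  blocks≤count d≤s (suc T) runs with Q T in QT
  ... | false = ≤-trans (blocks≤count d≤s T (runs-pred runs)) (count-mono P b (m≤n+m (T * d) d))
  ... | true  = begin
    d + count Q 0 T * d                         ≤⟨ +-mono-≤ (≤-reflexive (sym block))
                                                            (blocks≤count d≤s T (runs-pred runs)) ⟩
    count P (b + T * d) d + count P b (T * d)   ≡⟨ +-comm (count P (b + T * d) d) _ ⟩
    count P b (T * d) + count P (b + T * d) d   ≡⟨ count-+ P b (T * d) d ⟨
    count P b (T * d + d)                       ≡⟨ cong (count P b) (+-comm (T * d) d) ⟩
    count P b (d + T * d)                       ∎
    where
    open ≤-Reasoning
    block : count P (b + T * d) d ≡ d
    block = count-all P _ d (λ k k<d → proj₁ (runs T (n<1+n T) QT) k (<-≤-trans k<d d≤s))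

  runs⇒spans : d ≤ s → ∀ T → Runs T → Spans d s (count Q 0 T) (count P b (W ∸ b))
  runs⇒spans d≤s zero    _    = tt
  runs⇒spans d≤s (suc T) runs with Q T in QT
  ... | false = runs⇒spans d≤s T (runs-pred runs)
  ... | true  = begin
    count Q 0 T * d + s                         ≤⟨ +-monoˡ-≤ s (blocks≤count d≤s T (runs-pred runs)) ⟩
    count P b (T * d) + s                       ≡⟨ cong (count P b (T * d) +_) (count-all P _ s covered) ⟨
    count P b (T * d) + count P (b + T * d) s   ≡⟨ count-+ P b (T * d) s ⟨
    count P b (T * d + s)                       ≤⟨ count-mono P b (m+n≤o⇒m≤o∸n (T * d + s) ends) ⟩
    count P b (W ∸ b)                           ∎
    where
    open ≤-Reasoning
    covered : AllTrue P (b + T * d) s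
    covered = proj₁ (runs T (n<1+n T) QT)
    ends : T * d + s + b ≤ W
    ends = subst (_≤ W) (trans (+-assoc b (T * d) s) (+-comm b _)) (proj₂ (runs T (n<1+n T) QT))

d*[1+m]+ℓ≡d*m+s : ∀ d {ℓ s} → d + ℓ ≡ s → ∀ m → d * suc m + ℓ ≡ d * m + s
d*[1+m]+ℓ≡d*m+s d {ℓ} {s} d+ℓ≡s m = begin
  d * suc m + ℓ    ≡⟨ cong (_+ ℓ) (trans (*-suc d m) (+-comm d (d * m))) ⟩
  d * m + d + ℓ    ≡⟨ +-assoc (d * m) d ℓ ⟩
  d * m + (d + ℓ)  ≡⟨ cong (d * m +_) d+ℓ≡s ⟩
  d * m + s        ∎
  where open ≡-Reasoning

module Path {s ℓ m : ℕ} (ℓ<s : ℓ < s) where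

  private
    d = s ∸ ℓ
    n = d * suc m + ℓ

  n≡d*m+s : n ≡ d * m + s
  n≡d*m+s = d*[1+m]+ℓ≡d*m+s d (m∸n+n≡m (<⇒≤ ℓ<s)) m

  s≤n : s ≤ n
  s≤n = subst (s ≤_) (sym n≡d*m+s) (m≤n+m s (d * m))

  n∸s≡d*m : n ∸ s ≡ d * m
  n∸s≡d*m = trans (cong (_∸ s) n≡d*m+s) (m+n∸n≡m (d * m) s)

  path-spans : (H' : Sub (PathHG s ℓ (suc m))) → Spans d s ∣ E H' ∣ ∣ V H' ∣
  path-spans H' = subst₂ (Spans d s) (sym (∣p∣≡count-at (E H'))) (sym (∣p∣≡count-at (V H')))
    (runs⇒spans (at (V H')) (at (E H')) (m∸n≤m s ℓ) (suc m) runs)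
    where
    runs : Runs (at (V H')) (at (E H')) {0} {d} {s} {n} (suc m)
    runs t t<m Et with at⇒∈ (E H') t Et
    ... | i , refl , i∈E = covered , ends
      where
      ends : toℕ i * d + s ≤ n
      ends = subst (toℕ i * d + s ≤_) (sym n≡d*m+s)
               (+-monoˡ-≤ s (subst (toℕ i * d ≤_) (*-comm m d) (*-monoˡ-≤ d (s≤s⁻¹ t<m))))
      covered : AllTrue (at (V H')) (toℕ i * d) s
      covered k k<s = at-fromℕ< (V H') j<n (closed H' i _ i∈E
        (subst (λ j → toℕ i * d ≤ j × j < toℕ i * d + s) (sym (toℕ-fromℕ< j<n))
               (m≤m+n _ k , +-monoʳ-< _ k<s)))
        where
        j<n : toℕ i * d + k < n
        j<n = <-≤-trans (+-monoʳ-< _ k<s) ends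

module Cycle {s ℓ m : ℕ} (ℓ<s : ℓ < s) (s≤N : s ≤ (s ∸ ℓ) * suc m) where

  private
    d = s ∸ ℓ
    N = d * suc m
    d≤s : d ≤ s
    d≤s = m∸n≤m s ℓ
    instance
      d-nonZero : NonZero d
      d-nonZero = >-nonZero (m<n⇒0<n∸m ℓ<s)
      N-nonZero : NonZero N
      N-nonZero = >-nonZero (<-≤-trans (≤-<-trans z≤n ℓ<s) s≤N)

  N∸s+ℓ≡d*m : N ∸ s + ℓ ≡ d * m
  N∸s+ℓ≡d*m = +-cancelʳ-≡ s _ _ (begin
    N ∸ s + ℓ + s    ≡⟨ +-assoc (N ∸ s) ℓ s ⟩
    N ∸ s + (ℓ + s)  ≡⟨ cong (N ∸ s +_) (+-comm ℓ s) ⟩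
    N ∸ s + (s + ℓ)  ≡⟨ +-assoc (N ∸ s) s ℓ ⟨
    N ∸ s + s + ℓ    ≡⟨ cong (_+ ℓ) (m∸n+n≡m s≤N) ⟩
    N + ℓ            ≡⟨ d*[1+m]+ℓ≡d*m+s d (m∸n+n≡m (<⇒≤ ℓ<s)) m ⟩
    d * m + s        ∎)
    where open ≡-Reasoning

  ∈-cycleEdge : ∀ a k (i : Fin (suc m)) (j : Fin N) → k < s →
                toℕ i ≡ a % suc m → toℕ j ≡ (a * d + k) % N → CycleHG s ℓ (suc m) i j
  ∈-cycleEdge a k i j k<s i≡a j≡ad+k = k , k<s , x / N , (begin
    x                      ≡⟨ m≡m%n+[m/n]*n x N ⟩
    x % N + x / N * N      ≡⟨ cong (_+ x / N * N) x%N≡j ⟩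
    toℕ j + x / N * N      ∎)
    where
    open ≡-Reasoning
    open +-*-Solver
    x = toℕ i * d + k
    unwrap : a * d + k ≡ x + a / suc m * N
    unwrap = begin
      a * d + k                                      ≡⟨ cong (λ a → a * d + k) (m≡m%n+[m/n]*n a (suc m)) ⟩
      (a % suc m + a / suc m * suc m) * d + k        ≡⟨ solve 5 (λ r q m d k → (r :+ q :* m) :* d :+ k
                                                                          := r :* d :+ k :+ q :* (d :* m))
                                                          refl (a % suc m) (a / suc m) (suc m) d k ⟩
      a % suc m * d + k + a / suc m * N              ≡⟨ cong (λ r → r * d + k + a / suc m * N) i≡a ⟨
      x + a / suc m * N                              ∎
    x%N≡j : x % N ≡ toℕ j
    x%N≡j = begin
      x % N                          ≡⟨ [m+kn]%n≡m%n x (a / suc m) N ⟨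
      (x + a / suc m * N) % N        ≡⟨ cong (_% N) unwrap ⟨
      (a * d + k) % N                ≡⟨ j≡ad+k ⟨
      toℕ j                          ∎

  -- Unroll the cycle into the window [b, x + N) that starts just after the edge c through x.
  module Cut (H' : Sub (CycleHG s ℓ (suc m))) (x : Fin N) (x∉V : x ∉ V H') where

    private
      c = toℕ x / d
      b = suc c * d
      W = toℕ x + N
      Edge : ℕ → Bool
      Edge a = at (E H') (a % suc m)
      P Q : ℕ → Bool
      P j = at (V H') (j % N)
      Q t = Edge (suc c + t)

    edge-avoids-x : ∀ a k (i : Fin (suc m)) → k < s → toℕ i ≡ a % suc m → i ∈ E H' →
                    (a * d + k) % N ≡ toℕ x → ⊥
    edge-avoids-x a k i k<s i≡a i∈E hits = x∉V (closed H' i x i∈E (∈-cycleEdge a k i x k<s i≡a (sym hits)))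

    x≡x%d+c*d : toℕ x ≡ toℕ x % d + c * d
    x≡x%d+c*d = m≡m%n+[m/n]*n (toℕ x) d

    Edge-c≡false : Edge c ≡ false
    Edge-c≡false = ¬-not λ Edge-c → let (i , i≡c , i∈E) = at⇒∈ (E H') (c % suc m) Edge-c in
      edge-avoids-x c (toℕ x % d) i (<-≤-trans (m%n<n (toℕ x) d) d≤s) i≡c i∈E
        (trans (cong (_% N) (trans (+-comm (c * d) _) (sym x≡x%d+c*d))) (m<n⇒m%n≡m (toℕ<n x)))

    runs : Runs P Q {b} {d} {s} {W} m
    runs t t<m Qt with at⇒∈ (E H') ((suc c + t) % suc m) Qt
    ... | i , i≡a , i∈E = covered , ends
      where
      a = suc c + t
      b+td≡ad : b + t * d ≡ a * d
      b+td≡ad = sym (*-distribʳ-+ d (suc c) t)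
      covered : AllTrue P (b + t * d) s
      covered k k<s rewrite b+td≡ad = at-fromℕ< (V H') (m%n<n (a * d + k) N)
        (closed H' i _ i∈E (∈-cycleEdge a k i _ k<s i≡a (toℕ-fromℕ< _)))
      ad≤W : a * d ≤ W
      ad≤W = begin
        a * d             ≤⟨ *-monoˡ-≤ d (subst (_≤ c + m) (+-suc c t) (+-monoʳ-≤ c t<m)) ⟩
        (c + m) * d       ≡⟨ *-distribʳ-+ d c m ⟩
        c * d + m * d     ≤⟨ +-mono-≤ (subst (c * d ≤_) (sym x≡x%d+c*d) (m≤n+m (c * d) _))
                                      (subst (m * d ≤_) (*-comm (suc m) d) (m≤n+m (m * d) d)) ⟩
        toℕ x + N         ∎
        where open ≤-Reasoning
      ends : b + t * d + s ≤ W
      ends = ≮⇒≥ λ W<end → edge-avoids-x a (W ∸ a * d) i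
        (+-cancelˡ-< (a * d) _ s (subst₂ _<_ (sym (m+[n∸m]≡n ad≤W)) (cong (_+ s) b+td≡ad) W<end)) i≡a i∈E
        (trans (cong (_% N) (m+[n∸m]≡n ad≤W)) (trans ([m+n]%n≡m%n (toℕ x) N) (m<n⇒m%n≡m (toℕ<n x))))

    ∣E∣≡count-Q : ∣ E H' ∣ ≡ count Q 0 m
    ∣E∣≡count-Q = begin
      ∣ E H' ∣                          ≡⟨ ∣p∣≡count-at (E H') ⟩
      count (at (E H')) 0 (suc m)       ≡⟨ count-cong _ Edge 0 0 (suc m) (λ k k<m → cong (at (E H')) (sym (m<n⇒m%n≡m k<m))) ⟩
      count Edge 0 (suc m)              ≡⟨ count-periodic Edge (suc m) (λ a → cong (at (E H')) ([m+n]%n≡m%n a (suc m))) c ⟨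
      count Edge c (suc m)              ≡⟨ count-cons Edge c m ⟩
      𝟙 (Edge c) + count Edge (suc c) m ≡⟨ cong (λ e → 𝟙 e + count Edge (suc c) m) Edge-c≡false ⟩
      count Edge (suc c) m              ≡⟨ count-cong Edge Q (suc c) 0 m (λ _ _ → refl) ⟩
      count Q 0 m                       ∎
      where open ≡-Reasoning

    count-P≤∣V∣ : count P b (W ∸ b) ≤ ∣ V H' ∣
    count-P≤∣V∣ = begin
      count P b (W ∸ b)           ≤⟨ count-mono P b (m≤n+o⇒m∸n≤o W b (+-monoˡ-≤ N (<⇒≤ x<b))) ⟩
      count P b N                 ≡⟨ count-periodic P N (λ y → cong (at (V H')) ([m+n]%n≡m%n y N)) b ⟩
      count P 0 N                 ≡⟨ count-cong P (at (V H')) 0 0 N (λ k k<N → cong (at (V H')) (m<n⇒m%n≡m k<N)) ⟩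
      count (at (V H')) 0 N       ≡⟨ ∣p∣≡count-at (V H') ⟨
      ∣ V H' ∣                    ∎
      where
      open ≤-Reasoning
      x<b : toℕ x < b
      x<b = subst (_< b) (sym x≡x%d+c*d) (+-monoˡ-< (c * d) (m%n<n (toℕ x) d))

    cut-spans : Spans d s ∣ E H' ∣ ∣ V H' ∣
    cut-spans = subst (λ e → Spans d s e ∣ V H' ∣) (sym ∣E∣≡count-Q)
      (Spans-mono (count Q 0 m) (runs⇒spans P Q d≤s m runs) count-P≤∣V∣)

  cycle-spans : (H' : Sub (CycleHG s ℓ (suc m))) → ∣ V H' ∣ ≡ N ⊎ Spans d s ∣ E H' ∣ ∣ V H' ∣
  cycle-spans H' with all? (_∈? V H')
  ... | yes V-full = inj₁ (≤-antisym (∣p∣≤n (V H'))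
                       (subst (_≤ ∣ V H' ∣) (∣⊤∣≡n N) (p⊆q⇒∣p∣≤∣q∣ {p = ⊤ˢ} λ {j} _ → V-full j)))
  ... | no ¬V-full = let (x , x∉V) = ¬∀⟶∃¬ N _ (_∈? V H') ¬V-full in inj₂ (Cut.cut-spans H' x x∉V)

module _ {r s ℓ : ℕ} (1≤r : 1 ≤ r) (ℓ<s : ℓ < s) where

  private
    d = s ∸ ℓ

    retarget : ∀ {n m} {H : HG n m} {q q′} → q ≡ q′ →
               Σ (Sub H) (λ H' → (s ≤ ∣ V H' ∣) × (fSub s r H' ≡ q)) →
               Σ (Sub H) (λ H' → (s ≤ ∣ V H' ∣) × (fSub s r H' ≡ q′))
    retarget q≡q′ (H' , s≤V , f≡q) = H' , s≤V , trans f≡q q≡q′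

  path-μ-small : ∀ m → r ≤ d → IsMu (PathHG s ℓ (suc m)) s r (frac 1 r)
  path-μ-small m r≤d = firstEdge-attains (PathHG s ℓ (suc m)) s≤n (λ _ → proj₂)
                     , λ H' _ → density≤1/r 1≤r r≤d _ _ (path-spans H')
    where open Path {s} {ℓ} {m} ℓ<s

  path-μ-large : ∀ m → d < r → IsMu (PathHG s ℓ (suc m)) s r (frac (suc m) (d * suc m + ℓ ∸ s + r))
  path-μ-large m d<r = whole-attains (PathHG s ℓ (suc m)) s≤n
                     , λ H' _ → subst (λ X → fSub s r H' ℚ.≤ frac (suc m) (X + r)) (sym n∸s≡d*m)
                                  (density≤whole 1≤r (<⇒≤ d<r) ≤-refl _ _ (∣p∣≤n (E H')) (path-spans H'))
    where open Path {s} {ℓ} {m} ℓ<s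

  module _ (m : ℕ) (s≤N : s ≤ d * suc m) where

    private
      N = d * suc m
      X = N ∸ s
      A = frac (suc m) (X + r)
      B = frac 1 r

      X≤d*m : X ≤ d * m
      X≤d*m = subst (X ≤_) (Cycle.N∸s+ℓ≡d*m ℓ<s s≤N) (m≤m+n X ℓ)

      first⊆ : ∀ j → CycleHG s ℓ (suc m) fzero j → toℕ j < s
      first⊆ j (k , k<s , q , k≡j+qN) = ≤-<-trans (subst (toℕ j ≤_) (sym k≡j+qN) (m≤m+n (toℕ j) (q * N))) k<s

      density≤A⊔B : ∀ e v → e ≤ suc m → v ≡ N ⊎ Spans d s e v → frac e (v ∸ s + r) ℚ.≤ A ⊔ B
      density≤A⊔B e .N e≤m (inj₁ refl) =
        ℚᵖ.p≤q⇒p≤q⊔r B (frac+r-≤ 1≤r e X (suc m) X (*-monoˡ-≤ (X + r) e≤m))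
      density≤A⊔B e v e≤m (inj₂ spans) with ≤-total r d
      ... | inj₁ r≤d = ℚᵖ.p≤q⇒p≤r⊔q A (density≤1/r 1≤r r≤d e v spans)
      ... | inj₂ d≤r = ℚᵖ.p≤q⇒p≤q⊔r B (density≤whole 1≤r d≤r X≤d*m e v e≤m spans)

    cycle-μ : IsMu (CycleHG s ℓ (suc m)) s r (A ⊔ B)
    cycle-μ = witness (ℚᵖ.⊔-sel A B)
            , λ H' _ → density≤A⊔B _ _ (∣p∣≤n (E H')) (Cycle.cycle-spans ℓ<s s≤N H')
      where
      witness : A ⊔ B ≡ A ⊎ A ⊔ B ≡ B →
                Σ (Sub (CycleHG s ℓ (suc m))) λ H' → (s ≤ ∣ V H' ∣) × (fSub s r H' ≡ A ⊔ B)
      witness (inj₁ A⊔B≡A) = retarget (sym A⊔B≡A) (whole-attains (CycleHG s ℓ (suc m)) s≤N)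
      witness (inj₂ A⊔B≡B) = retarget (sym A⊔B≡B) (firstEdge-attains (CycleHG s ℓ (suc m)) s≤N first⊆)

    cycle-max-large : d ≤ r → A ⊔ B ≡ A
    cycle-max-large d≤r = ℚᵖ.p≥q⇒p⊔q≡p (frac+r-≤ 1≤r 1 0 (suc m) X (begin
      1 * (X + r)   ≡⟨ *-identityˡ (X + r) ⟩
      X + r         ≤⟨ +-monoˡ-≤ r (≤-trans X≤d*m (subst (d * m ≤_) (*-comm r m) (*-monoˡ-≤ m d≤r))) ⟩
      m * r + r     ≡⟨ +-comm (m * r) r ⟩
      suc m * r     ∎))
      where open ≤-Reasoning

    cycle-max-small : 1 ≤ ℓ → r + 2 * ℓ ≤ s → A ⊔ B ≡ B
    cycle-max-small 1≤ℓ r+2ℓ≤s = ℚᵖ.p≤q⇒p⊔q≡q (frac+r-≤ 1≤r (suc m) X 1 0 (begin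
      r + m * r     ≤⟨ +-monoʳ-≤ r (+-cancelʳ-≤ ℓ (m * r) X m*r+ℓ≤X+ℓ) ⟩
      r + X         ≡⟨ +-comm r X ⟩
      X + r         ≡⟨ *-identityˡ (X + r) ⟨
      1 * (X + r)   ∎))
      where
      open ≤-Reasoning
      r+ℓ≤d : r + ℓ ≤ d
      r+ℓ≤d = m+n≤o⇒m≤o∸n (r + ℓ) (subst (_≤ s) r+2ℓ≡r+ℓ+ℓ r+2ℓ≤s)
        where
        r+2ℓ≡r+ℓ+ℓ : r + 2 * ℓ ≡ r + ℓ + ℓ
        r+2ℓ≡r+ℓ+ℓ = trans (cong (λ x → r + (ℓ + x)) (+-identityʳ ℓ)) (sym (+-assoc r ℓ ℓ))
      d<s : d < s
      d<s = ∸-monoʳ-< 1≤ℓ (<⇒≤ ℓ<s)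
      1≤m : 1 ≤ m
      1≤m = ≮⇒≥ λ { (s≤s z≤n) → <⇒≱ d<s (subst (s ≤_) (*-identityʳ d) s≤N) }
      m*r+ℓ≤X+ℓ : m * r + ℓ ≤ X + ℓ
      m*r+ℓ≤X+ℓ = begin
        m * r + ℓ          ≤⟨ +-monoʳ-≤ (m * r) (subst (ℓ ≤_) (*-comm ℓ m) (m≤m*n ℓ m {{>-nonZero 1≤m}})) ⟩
        m * r + m * ℓ      ≡⟨ *-distribˡ-+ m r ℓ ⟨
        m * (r + ℓ)        ≤⟨ *-monoʳ-≤ m r+ℓ≤d ⟩
        m * d              ≡⟨ *-comm m d ⟩
        d * m              ≡⟨ Cycle.N∸s+ℓ≡d*m ℓ<s s≤N ⟨
        X + ℓ              ∎

claim3 : (r s ℓ : ℕ) → 2 ≤ r → r ≤ s → 1 ≤ ℓ → ℓ < s →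
    ((m : ℕ) → 1 ≤ m →
        (r ≤ s ∸ ℓ → IsMu (PathHG s ℓ m) s r (frac 1 r))
      × (s ∸ ℓ < r → IsMu (PathHG s ℓ m) s r (frac m ((s ∸ ℓ) * m + ℓ ∸ s + r))))
    × ((m : ℕ) → floorDiv (1 + s) (s ∸ ℓ) ≤ m → s ≤ (s ∸ ℓ) * m →
        IsMu (CycleHG s ℓ m) s r (frac m ((s ∸ ℓ) * m ∸ s + r) ⊔ frac 1 r)
      × (r + 2 * ℓ ≤ s → frac m ((s ∸ ℓ) * m ∸ s + r) ⊔ frac 1 r ≡ frac 1 r)
      × (s ∸ ℓ ≤ r → frac m ((s ∸ ℓ) * m ∸ s + r) ⊔ frac 1 r ≡ frac m ((s ∸ ℓ) * m ∸ s + r))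
      × (s ∸ ℓ ≤ r → Balanced (CycleHG s ℓ m) s r))
claim3 r s ℓ 2≤r _ 1≤ℓ ℓ<s =
    (λ { zero    ()
       ; (suc m) _ → path-μ-small 1≤r ℓ<s m , path-μ-large 1≤r ℓ<s m })
  , (λ { zero    _ s≤0 → ⊥-elim (<⇒≱ (≤-<-trans z≤n ℓ<s) (subst (s ≤_) (*-zeroʳ (s ∸ ℓ)) s≤0))
       ; (suc m) _ s≤N → cycle-μ 1≤r ℓ<s m s≤N
                       , cycle-max-small 1≤r ℓ<s m s≤N 1≤ℓ
                       , cycle-max-large 1≤r ℓ<s m s≤N
                       , λ d≤r → subst (IsMu (CycleHG s ℓ (suc m)) s r) (cycle-max-large 1≤r ℓ<s m s≤N d≤r)
                                       (cycle-μ 1≤r ℓ<s m s≤N) })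
  where
  1≤r : 1 ≤ r
  1≤r = ≤-trans (s≤s z≤n) 2≤r
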